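{- Let $a,b$ be positive integers and $n\ge 0$. The number $h^{a,b}_n$ of tilings of the honeycomb strip $H_n$ by monomers of $a$ colors and dimers of $b$ colors satisfies $$h^{a,b}_n=\sum_{k=0}^{\lfloor n/2\rfloor}c_{n,k}\,a^{n-2k}b^k=\sum_{k=0}^{\lfloor n/2\rfloor}\sum_{m=0}^{k}\binom{n-k-m}{m}\binom{n-k-m}{k-m}a^{n-2k}b^k,$$ where $c_{n,k}$ is the number of (uncolored) tilings of $H_n$ with exactly $k$ dimers and $n-2k$ monomers.
   Context: The honeycomb strip $H_n$ consists of $n$ regular hexagons arranged in two rows, numbered $1,\dots,n$ from the bottom left so that odd-numbered hexagons form the bottom row and even-numbered ones the top row; hexagon $i$ shares an edge with hexagons $i\pm1$ and $i\pm2$ (when they exist), and with no others. A monomer is a single hexagon; a dimer is a pair of edge-adjacent hexagons, i.e. either $\{i,i+1\}$ (slanted) or $\{i,i+2\}$ (horizontal). A tiling of $H_n$ is a partition of its hexagons into monomers and dimers; in a colored tiling each monomer receives one of $a$ colors and each dimer one of $b$ colors. Binomial coefficients with lower index negative or exceeding the upper index are $0$. -}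

module Defs where

open import Data.Nat using (ℕ; zero; suc; _+_; _*_; _∸_; _^_; _≡ᵇ_; ⌊_/2⌋)
open import Data.Nat.Combinatorics using (_C_)
open import Data.Bool using (Bool; true; false; _∧_; _∨_; not; if_then_else_)
open import Data.List using (List; []; _∷_; _++_; map; concatMap; length; filter; upTo)
open import Data.Nat.ListAction using (sum)
open import Data.Bool.ListAction using (all; any)
open import Data.Fin using (Fin)
open import Data.List using (allFin)
open import Data.Vec using (Vec; []; _∷_)
open import Data.Product using (_×_; _,_; proj₁; proj₂; Σ)
open import Relation.Nullary.Decidable using (Dec; yes; no)
open import Relation.Binary.PropositionalEquality using (_≡_)
import Data.Nat as ℕ

-- Hexagons of H_n are numbered 0,…,n-1 (the paper's i is our i-1).
-- Hexagon i is edge-adjacent exactly to i±1 and i±2.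

-- A dimer is a pair of edge-adjacent hexagons {i, j} with i < j,
-- i.e. j = i+1 (slanted) or j = i+2 (horizontal).
Dimer : Set
Dimer = ℕ × ℕ

dimers : ℕ → List Dimer
dimers n = map (λ i → (i , suc i)) (upTo (n ∸ 1))
        ++ map (λ i → (i , suc (suc i))) (upTo (n ∸ 2))

data Tile : Set where
  mono  : ℕ → Tile
  dimer : Dimer → Tile

sublists : {A : Set} → List A → List (List A)
sublists [] = [] ∷ []
sublists (x ∷ xs) = let r = sublists xs in map (x ∷_) r ++ r

covers : Dimer → ℕ → Bool
covers (i , j) h = (i ≡ᵇ h) ∨ (j ≡ᵇ h)

disjoint : Dimer → Dimer → Bool
disjoint (i , j) d = not (covers d i) ∧ not (covers d j)

pairwiseDisjoint : List Dimer → Bool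
pairwiseDisjoint [] = true
pairwiseDisjoint (d ∷ ds) = all (disjoint d) ds ∧ pairwiseDisjoint ds

-- A tiling of H_n (a partition of the hexagons into monomers and dimers)
-- is determined by its set of dimers, which must be pairwise disjoint;
-- every remaining hexagon is a monomer.  We enumerate tilings by their
-- (duplicate-free, ordered) dimer sets.
tilings : ℕ → List (List Dimer)
tilings n = filter (λ ds → Data.Bool._≟_ (pairwiseDisjoint ds) true) (sublists (dimers n))
  where import Data.Bool

monomers : ℕ → List Dimer → List ℕ
monomers n ds = filter (λ h → Data.Bool._≟_ (any (λ d → covers d h) ds) false) (upTo n)
  where import Data.Bool

tiles : ℕ → List Dimer → List Tile
tiles n ds = map mono (monomers n ds) ++ map dimer ds

c : ℕ → ℕ → ℕ
c n k = length (filter (λ ds → length ds ℕ.≟ k) (tilings n))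

allVecs : (a m : ℕ) → List (Vec (Fin a) m)
allVecs a zero = [] ∷ []
allVecs a (suc m) = concatMap (λ v → map (_∷ v) (allFin a)) (allVecs a m)

-- A colored tiling: a tiling together with a colour (out of a) for each of
-- its monomers and a colour (out of b) for each of its dimers.
ColoredTiling : (a b : ℕ) → Set
ColoredTiling a b =
  Σ (List Dimer) λ ds → Σ ℕ λ m → Vec (Fin a) m × Vec (Fin b) (length ds)

coloredTilings : (a b n : ℕ) → List (ColoredTiling a b)
coloredTilings a b n =
  concatMap (λ ds →
    let m = length (monomers n ds) in
    concatMap (λ u → map (λ v → (ds , m , u , v)) (allVecs b (length ds)))
              (allVecs a m))
  (tilings n)

h : (a b n : ℕ) → ℕ
h a b n = length (coloredTilings a b n)

Σ≤ : ℕ → (ℕ → ℕ) → ℕ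
Σ≤ K f = sum (map f (upTo (suc K)))

-- A tiling is determined by its set of dimers, and a tiling with k dimers has n − 2k monomers, so it
-- carries a^(n−2k) b^k colourings; grouping the tilings by k gives the first formula. For the second,
-- both c n k and the binomial double sum satisfy
--   c(n, k) = c(n−1, k) + c(n−2, k−1) + c(n−3, k−1) + c(n−4, k−2):
-- the last hexagon n−1 is a monomer, or lies in the slanted dimer {n−2, n−1}, or in the horizontal
-- dimer {n−3, n−1}, and then hexagon n−2 is a monomer or lies in {n−4, n−2}. Dimer sets are counted
-- recursively, forbidding the hexagons of each chosen dimer. On the binomial side the sum runs over
-- m + i = k of C(Y, m) C(Y, i) with Y = n − 2m − i, and the recurrence is Pascal's rule applied to
-- both factors.

module Submission where

open import Defs
open import Data.Nat using (ℕ; zero; suc; _+_; _*_; _∸_; _^_; _≤_; _<_; _≡ᵇ_; _≟_; _≤?_; ⌊_/2⌋; z≤n; s≤s)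
open import Data.Nat.Properties
open import Data.Nat.Combinatorics using (_C_; nCk+nC[k+1]≡[n+1]C[k+1])
open import Data.Nat.ListAction using (sum)
open import Data.Nat.Tactic.RingSolver using (solve-∀)
open import Data.Bool using (Bool; true; false; _∧_; _∨_; not; if_then_else_; T)
open import Data.Bool.Properties
  using (∨-∧-booleanAlgebra; ∧-commutativeMonoid; ∨-comm; ∧-zeroʳ; ∨-zeroʳ; ∧-identityʳ; ∧-comm)
open import Data.Bool.ListAction using (all; and; any)
open import Data.Unit using (⊤; tt)
import Data.Bool as Bool
open import Data.List using (List; []; _∷_; _++_; _∷ʳ_; map; upTo; applyUpTo; length; filter; concatMap; allFin)
open import Data.List.Relation.Unary.All as All using (All; []; _∷_)
open import Data.List.Relation.Unary.All.Properties using (++⁺; map⁺; applyUpTo⁺₁; all-upTo; filter⁺; all-filter)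
open import Data.List.Relation.Binary.Permutation.Propositional as ↭ using (_↭_; module PermutationReasoning)
open import Data.List.Relation.Binary.Permutation.Propositional.Properties using (shift; ++-comm)
open import Data.List.Properties
  using (map-upTo; applyUpTo-∷ʳ; upTo-∷ʳ; length-upTo; length-map; length-++; length-tabulate; ++-assoc; map-cong)
open import Data.Product using (_×_; _,_; proj₁; proj₂)
open import Function using (_∘_; mk⇔)
open import Relation.Nullary using (yes; no; does)
open import Relation.Unary using (Pred; Decidable)
open import Level using (0ℓ)
open import Relation.Nullary.Decidable using (dec-true; dec-false; does-⇔)
open import Relation.Binary.PropositionalEquality
open import Algebra.Bundles using (CommutativeMonoid)
open import Algebra.Properties.CommutativeSemigroup +-commutativeSemigroup using (interchange; x∙yz≈y∙xz)
open import Algebra.Properties.CommutativeSemigroup (CommutativeMonoid.commutativeSemigroup ∧-commutativeMonoid)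
  using () renaming (interchange to ∧-interchange)
open import Algebra.Lattice.Properties.BooleanAlgebra ∨-∧-booleanAlgebra using (deMorgan₂)

-- Finite sums

Σ< : ℕ → (ℕ → ℕ) → ℕ
Σ< zero    f = 0
Σ< (suc n) f = f 0 + Σ< n (f ∘ suc)

sum-map-applyUpTo : ∀ n (f g : ℕ → ℕ) → sum (map f (applyUpTo g n)) ≡ Σ< n (f ∘ g)
sum-map-applyUpTo zero    f g = refl
sum-map-applyUpTo (suc n) f g = cong (f (g 0) +_) (sum-map-applyUpTo n f (g ∘ suc))

Σ≤≡Σ< : ∀ K f → Σ≤ K f ≡ Σ< (suc K) f
Σ≤≡Σ< K f = sum-map-applyUpTo (suc K) f (λ x → x)

Σ<-cong : ∀ n {f g : ℕ → ℕ} → (∀ m → m < n → f m ≡ g m) → Σ< n f ≡ Σ< n g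
Σ<-cong zero    eq = refl
Σ<-cong (suc n) eq = cong₂ _+_ (eq 0 (s≤s z≤n)) (Σ<-cong n (λ m m<n → eq (suc m) (s≤s m<n)))

Σ<-+ : ∀ n (f g : ℕ → ℕ) → Σ< n (λ m → f m + g m) ≡ Σ< n f + Σ< n g
Σ<-+ zero    f g = refl
Σ<-+ (suc n) f g =
  trans (cong (f 0 + g 0 +_) (Σ<-+ n (f ∘ suc) (g ∘ suc))) (interchange (f 0) (g 0) _ _)

Σ<-*ʳ : ∀ n (f : ℕ → ℕ) x → Σ< n (λ m → f m * x) ≡ Σ< n f * x
Σ<-*ʳ zero    f x = refl
Σ<-*ʳ (suc n) f x =
  trans (cong (f 0 * x +_) (Σ<-*ʳ n (f ∘ suc) x)) (sym (*-distribʳ-+ x (f 0) _))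

Σ<-zero : ∀ n (f : ℕ → ℕ) → (∀ m → f m ≡ 0) → Σ< n f ≡ 0
Σ<-zero zero    f eq = refl
Σ<-zero (suc n) f eq = cong₂ _+_ (eq 0) (Σ<-zero n (f ∘ suc) (eq ∘ suc))

δ : ℕ → ℕ → ℕ
δ j k = if j ≡ᵇ k then 1 else 0

Σ<-δ : ∀ n j (g : ℕ → ℕ) → j < n → Σ< n (λ k → δ j k * g k) ≡ g j
Σ<-δ (suc n) zero    g _         =
  trans (cong₂ _+_ (*-identityˡ (g 0)) (Σ<-zero n _ (λ _ → refl))) (+-identityʳ (g 0))
Σ<-δ (suc n) (suc j) g (s≤s j<n) = Σ<-δ n j (g ∘ suc) j<n

antidiagonalSum : ℕ → (ℕ → ℕ → ℕ) → ℕ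
antidiagonalSum zero    g = g 0 0
antidiagonalSum (suc k) g = g 0 (suc k) + antidiagonalSum k (g ∘ suc)

Σ<≡antidiagonalSum : ∀ k (g : ℕ → ℕ → ℕ) → Σ< (suc k) (λ m → g m (k ∸ m)) ≡ antidiagonalSum k g
Σ<≡antidiagonalSum zero    g = +-identityʳ (g 0 0)
Σ<≡antidiagonalSum (suc k) g = cong (g 0 (suc k) +_) (Σ<≡antidiagonalSum k (g ∘ suc))

antidiagonalSum-cong : ∀ k {f g : ℕ → ℕ → ℕ} → (∀ m i → f m i ≡ g m i) →
                       antidiagonalSum k f ≡ antidiagonalSum k g
antidiagonalSum-cong zero    eq = eq 0 0
antidiagonalSum-cong (suc k) eq = cong₂ _+_ (eq 0 (suc k)) (antidiagonalSum-cong k (eq ∘ suc))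

antidiagonalSum-+ : ∀ k (f g : ℕ → ℕ → ℕ) →
  antidiagonalSum k (λ m i → f m i + g m i) ≡ antidiagonalSum k f + antidiagonalSum k g
antidiagonalSum-+ zero    f g = refl
antidiagonalSum-+ (suc k) f g =
  trans (cong (f 0 (suc k) + g 0 (suc k) +_) (antidiagonalSum-+ k (f ∘ suc) (g ∘ suc)))
        (interchange (f 0 (suc k)) (g 0 (suc k)) _ _)

shiftˡ shiftʳ : (ℕ → ℕ → ℕ) → ℕ → ℕ → ℕ
shiftˡ g zero    i = 0
shiftˡ g (suc m) i = g m i
shiftʳ g m zero    = 0
shiftʳ g m (suc i) = g m i

antidiagonalSum-shiftʳ : ∀ k g → antidiagonalSum (suc k) (shiftʳ g) ≡ antidiagonalSum k g
antidiagonalSum-shiftʳ zero    g = +-identityʳ (g 0 0)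
antidiagonalSum-shiftʳ (suc k) g = cong (g 0 (suc k) +_) (begin
  antidiagonalSum (suc k) (shiftʳ g ∘ suc)   ≡⟨ antidiagonalSum-cong (suc k) shiftʳ-suc ⟩
  antidiagonalSum (suc k) (shiftʳ (g ∘ suc)) ≡⟨ antidiagonalSum-shiftʳ k (g ∘ suc) ⟩
  antidiagonalSum k (g ∘ suc)                ∎)
  where
  open ≡-Reasoning
  shiftʳ-suc : ∀ m i → shiftʳ g (suc m) i ≡ shiftʳ (g ∘ suc) m i
  shiftʳ-suc m zero    = refl
  shiftʳ-suc m (suc i) = refl

-- The binomial double sum

C² : ℕ → ℕ → ℕ → ℕ
C² Y a b = (Y C a) * (Y C b)

pascalSum : (f g h e : ℕ → ℕ → ℕ) → ℕ → ℕ → ℕ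
pascalSum f g h e a b = f a b + shiftʳ g a b + shiftˡ h a b + shiftˡ (shiftʳ e) a b

C²-pascal : ∀ Y a b → C² (suc Y) a b ≡ pascalSum (C² Y) (C² Y) (C² Y) (C² Y) a b
C²-pascal Y zero    zero    = refl
C²-pascal Y zero    (suc b) =
  trans (cong (1 *_) (sym (nCk+nC[k+1]≡[n+1]C[k+1] Y b))) (ring (Y C b) (Y C suc b))
  where
  ring : ∀ B B′ → 1 * (B + B′) ≡ 1 * B′ + 1 * B + 0 + 0
  ring = solve-∀
C²-pascal Y (suc a) zero    =
  trans (cong (_* 1) (sym (nCk+nC[k+1]≡[n+1]C[k+1] Y a))) (ring (Y C a) (Y C suc a))
  where
  ring : ∀ A A′ → (A + A′) * 1 ≡ A′ * 1 + 0 + A * 1 + 0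
  ring = solve-∀
C²-pascal Y (suc a) (suc b) =
  trans (cong₂ _*_ (sym (nCk+nC[k+1]≡[n+1]C[k+1] Y a)) (sym (nCk+nC[k+1]≡[n+1]C[k+1] Y b)))
        (ring (Y C a) (Y C suc a) (Y C b) (Y C suc b))
  where
  ring : ∀ A A′ B B′ → (A + A′) * (B + B′) ≡ A′ * B′ + A′ * B + A * B′ + A * B
  ring = solve-∀

C²-pascal-zero : ∀ a b → 3 < a + a + b → C² 0 a b ≡ pascalSum (C² 0) (C² 0) (C² 0) (C² 0) a b
C²-pascal-zero zero          zero          ()
C²-pascal-zero zero          (suc zero)    (s≤s ())
C²-pascal-zero zero          (suc (suc b)) _ = refl
C²-pascal-zero (suc zero)    zero          (s≤s (s≤s ()))
C²-pascal-zero (suc zero)    (suc zero)    (s≤s (s≤s (s≤s ())))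
C²-pascal-zero (suc zero)    (suc (suc b)) _ = refl
C²-pascal-zero (suc (suc a)) zero          _ = refl
C²-pascal-zero (suc (suc a)) (suc b)       _ = refl

antidiagonalSum-pascalSum₁ : ∀ f g h e →
  antidiagonalSum 1 (pascalSum f g h e) ≡ antidiagonalSum 1 f + g 0 0 + h 0 0
antidiagonalSum-pascalSum₁ f g h e = ring (f 0 1) (g 0 0) (f 1 0) (h 0 0)
  where
  ring : ∀ x y z w → x + y + 0 + 0 + (z + 0 + w + 0) ≡ x + z + y + w
  ring = solve-∀

antidiagonalSum-pascalSum : ∀ k f g h e →
  antidiagonalSum (2 + k) (pascalSum f g h e)
  ≡ antidiagonalSum (2 + k) f + antidiagonalSum (1 + k) g + antidiagonalSum (1 + k) h + antidiagonalSum k e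
antidiagonalSum-pascalSum k f g h e = begin
  antidiagonalSum (2 + k) (pascalSum f g h e)
    ≡⟨ antidiagonalSum-+ (2 + k) (λ a b → f a b + shiftʳ g a b + shiftˡ h a b) (shiftˡ (shiftʳ e)) ⟩
  antidiagonalSum (2 + k) (λ a b → f a b + shiftʳ g a b + shiftˡ h a b)
    + antidiagonalSum (2 + k) (shiftˡ (shiftʳ e))
    ≡⟨ cong (_+ antidiagonalSum (2 + k) (shiftˡ (shiftʳ e)))
            (trans (antidiagonalSum-+ (2 + k) (λ a b → f a b + shiftʳ g a b) (shiftˡ h))
                   (cong (_+ antidiagonalSum (2 + k) (shiftˡ h)) (antidiagonalSum-+ (2 + k) f (shiftʳ g)))) ⟩
  antidiagonalSum (2 + k) f + antidiagonalSum (2 + k) (shiftʳ g)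
    + antidiagonalSum (2 + k) (shiftˡ h) + antidiagonalSum (2 + k) (shiftˡ (shiftʳ e))
    ≡⟨ cong₂ _+_ (cong (λ x → antidiagonalSum (2 + k) f + x + antidiagonalSum (1 + k) h) (antidiagonalSum-shiftʳ (1 + k) g))
                 (antidiagonalSum-shiftʳ k e) ⟩
  antidiagonalSum (2 + k) f + antidiagonalSum (1 + k) g + antidiagonalSum (1 + k) h + antidiagonalSum k e
    ∎
  where open ≡-Reasoning

binomialTerm : ℕ → ℕ → ℕ → ℕ
binomialTerm n m i = C² (n ∸ (m + m + i)) m i

binomialTerm-rec : ∀ N m i → binomialTerm (4 + N) m i ≡
  pascalSum (binomialTerm (3 + N)) (binomialTerm (2 + N)) (binomialTerm (1 + N)) (binomialTerm N) m i
binomialTerm-rec N m i =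
  trans pascal
        (sym (cong₂ _+_ (cong₂ _+_ (cong (binomialTerm (3 + N) m i +_) (shiftedʳ m i)) (shiftedˡ m i))
                        (shiftedˡʳ m i)))
  where
  Y : ℕ → ℕ → ℕ
  Y m i = (3 + N) ∸ (m + m + i)
  pascal : C² ((4 + N) ∸ (m + m + i)) m i ≡ pascalSum (C² (Y m i)) (C² (Y m i)) (C² (Y m i)) (C² (Y m i)) m i
  pascal with m + m + i ≤? 3 + N
  ... | yes s≤ rewrite +-∸-assoc 1 s≤ = C²-pascal (Y m i) m i
  -- Otherwise truncated subtraction makes both upper indices 0, and every term vanishes.
  ... | no  s≰ rewrite m≤n⇒m∸n≡0 (≰⇒> s≰) | m≤n⇒m∸n≡0 (<⇒≤ (≰⇒> s≰)) =
    C²-pascal-zero m i (≤-trans (m≤m+n 4 N) (≰⇒> s≰))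
  index₂ : ∀ m i → suc m + suc m + i ≡ 2 + (m + m + i)
  index₂ = solve-∀
  index₃ : ∀ m i → suc m + suc m + suc i ≡ 3 + (m + m + i)
  index₃ = solve-∀
  shiftedʳ : ∀ m i → shiftʳ (binomialTerm (2 + N)) m i ≡ shiftʳ (C² (Y m i)) m i
  shiftedʳ m zero    = refl
  shiftedʳ m (suc i) = cong (λ s → C² ((3 + N) ∸ s) m i) (sym (+-suc (m + m) i))
  shiftedˡ : ∀ m i → shiftˡ (binomialTerm (1 + N)) m i ≡ shiftˡ (C² (Y m i)) m i
  shiftedˡ zero    i = refl
  shiftedˡ (suc m) i = cong (λ s → C² ((3 + N) ∸ s) m i) (sym (index₂ m i))
  shiftedˡʳ : ∀ m i → shiftˡ (shiftʳ (binomialTerm N)) m i ≡ shiftˡ (shiftʳ (C² (Y m i))) m i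
  shiftedˡʳ zero    i       = refl
  shiftedˡʳ (suc m) zero    = refl
  shiftedˡʳ (suc m) (suc i) = cong (λ s → C² ((3 + N) ∸ s) m i) (sym (index₃ m i))

binomialCount : ℕ → ℕ → ℕ
binomialCount n k = Σ≤ k (λ m → ((n ∸ k ∸ m) C m) * ((n ∸ k ∸ m) C (k ∸ m)))

binomialCount≡antidiagonalSum : ∀ n k → binomialCount n k ≡ antidiagonalSum k (binomialTerm n)
binomialCount≡antidiagonalSum n k =
  trans (Σ≤≡Σ< k _) (trans (Σ<-cong (suc k) term) (Σ<≡antidiagonalSum k (binomialTerm n)))
  where
  term : ∀ m → m < suc k → ((n ∸ k ∸ m) C m) * ((n ∸ k ∸ m) C (k ∸ m)) ≡ binomialTerm n m (k ∸ m)
  term m (s≤s m≤k) = cong (λ Y → C² Y m (k ∸ m)) (trans (∸-+-assoc n k m) (cong (n ∸_) index))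
    where
    index : k + m ≡ m + m + (k ∸ m)
    index = begin
      k + m            ≡⟨ +-comm k m ⟩
      m + k            ≡⟨ cong (m +_) (m+[n∸m]≡n m≤k) ⟨
      m + (m + (k ∸ m)) ≡⟨ +-assoc m m (k ∸ m) ⟨
      m + m + (k ∸ m)  ∎
      where open ≡-Reasoning

binomialCount-vanishes : ∀ n k → n ≤ suc k → binomialCount n (suc k) ≡ 0
binomialCount-vanishes n k n≤ = trans (Σ≤≡Σ< (suc k) summand) (Σ<-zero (2 + k) summand term)
  where
  summand : ℕ → ℕ
  summand m = ((n ∸ suc k ∸ m) C m) * ((n ∸ suc k ∸ m) C (suc k ∸ m))
  term : ∀ m → summand m ≡ 0
  term zero    rewrite m≤n⇒m∸n≡0 n≤ = refl
  term (suc m) rewrite m≤n⇒m∸n≡0 n≤ = refl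

binomialCount-rec₁ : ∀ N →
  binomialCount (4 + N) 1 ≡ binomialCount (3 + N) 1 + binomialCount (2 + N) 0 + binomialCount (1 + N) 0
binomialCount-rec₁ N = begin
  binomialCount (4 + N) 1
    ≡⟨ binomialCount≡antidiagonalSum (4 + N) 1 ⟩
  antidiagonalSum 1 (binomialTerm (4 + N))
    ≡⟨ antidiagonalSum-cong 1 (binomialTerm-rec N) ⟩
  antidiagonalSum 1 (pascalSum (binomialTerm (3 + N)) (binomialTerm (2 + N)) (binomialTerm (1 + N)) (binomialTerm N))
    ≡⟨ antidiagonalSum-pascalSum₁ (binomialTerm (3 + N)) (binomialTerm (2 + N)) (binomialTerm (1 + N)) (binomialTerm N) ⟩
  antidiagonalSum 1 (binomialTerm (3 + N)) + 1 + 1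
    ≡⟨ cong (λ x → x + 1 + 1) (binomialCount≡antidiagonalSum (3 + N) 1) ⟨
  binomialCount (3 + N) 1 + binomialCount (2 + N) 0 + binomialCount (1 + N) 0
    ∎
  where open ≡-Reasoning

binomialCount-rec₂ : ∀ N k →
  binomialCount (4 + N) (2 + k)
  ≡ binomialCount (3 + N) (2 + k) + binomialCount (2 + N) (1 + k) + binomialCount (1 + N) (1 + k) + binomialCount N k
binomialCount-rec₂ N k = begin
  binomialCount (4 + N) (2 + k)
    ≡⟨ binomialCount≡antidiagonalSum (4 + N) (2 + k) ⟩
  antidiagonalSum (2 + k) (binomialTerm (4 + N))
    ≡⟨ antidiagonalSum-cong (2 + k) (binomialTerm-rec N) ⟩
  antidiagonalSum (2 + k) (pascalSum (binomialTerm (3 + N)) (binomialTerm (2 + N)) (binomialTerm (1 + N)) (binomialTerm N))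
    ≡⟨ antidiagonalSum-pascalSum k (binomialTerm (3 + N)) (binomialTerm (2 + N)) (binomialTerm (1 + N)) (binomialTerm N) ⟩
  antidiagonalSum (2 + k) (binomialTerm (3 + N)) + antidiagonalSum (1 + k) (binomialTerm (2 + N))
    + antidiagonalSum (1 + k) (binomialTerm (1 + N)) + antidiagonalSum k (binomialTerm N)
    ≡⟨ cong₂ _+_ (cong₂ _+_ (cong₂ _+_ (W (3 + N) (2 + k)) (W (2 + N) (1 + k))) (W (1 + N) (1 + k))) (W N k) ⟨
  binomialCount (3 + N) (2 + k) + binomialCount (2 + N) (1 + k) + binomialCount (1 + N) (1 + k) + binomialCount N k
    ∎
  where
  open ≡-Reasoning
  W = binomialCount≡antidiagonalSum

-- Matchings of the honeycomb strip

≡ᵇ-refl : ∀ a → (a ≡ᵇ a) ≡ true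
≡ᵇ-refl a = dec-true (a ≟ a) refl

≡ᵇ-sym : ∀ a b → (a ≡ᵇ b) ≡ (b ≡ᵇ a)
≡ᵇ-sym a b = does-⇔ (mk⇔ sym sym) (a ≟ b) (b ≟ a)

<⇒≡ᵇ-false : ∀ {a b} → a < b → (a ≡ᵇ b) ≡ false
<⇒≡ᵇ-false {a} {b} a<b = dec-false (a ≟ b) (<⇒≢ a<b)

>⇒≡ᵇ-false : ∀ {a b} → b < a → (a ≡ᵇ b) ≡ false
>⇒≡ᵇ-false {a} {b} b<a = dec-false (a ≟ b) (>⇒≢ b<a)

≡ᵇ-true⇒≡ : ∀ a b → (a ≡ᵇ b) ≡ true → a ≡ b
≡ᵇ-true⇒≡ a b eq = ≡ᵇ⇒≡ a b (subst T (sym eq) tt)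

nor-interchange : ∀ a b c d → not (a ∨ b) ∧ not (c ∨ d) ≡ not (a ∨ c) ∧ not (b ∨ d)
nor-interchange a b c d = begin
  not (a ∨ b) ∧ not (c ∨ d)          ≡⟨ cong₂ _∧_ (deMorgan₂ a b) (deMorgan₂ c d) ⟩
  (not a ∧ not b) ∧ (not c ∧ not d)  ≡⟨ ∧-interchange (not a) (not b) (not c) (not d) ⟩
  (not a ∧ not c) ∧ (not b ∧ not d)  ≡⟨ cong₂ _∧_ (deMorgan₂ a c) (deMorgan₂ b d) ⟨
  not (a ∨ c) ∧ not (b ∨ d)          ∎
  where open ≡-Reasoning

disjoint-sym : ∀ x y → disjoint x y ≡ disjoint y x
disjoint-sym (x₁ , x₂) (y₁ , y₂) =
  trans (nor-interchange (y₁ ≡ᵇ x₁) (y₂ ≡ᵇ x₁) (y₁ ≡ᵇ x₂) (y₂ ≡ᵇ x₂))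
        (cong₂ _∧_ (cong₂ (λ a b → not (a ∨ b)) (≡ᵇ-sym y₁ x₁) (≡ᵇ-sym y₁ x₂))
                   (cong₂ (λ a b → not (a ∨ b)) (≡ᵇ-sym y₂ x₁) (≡ᵇ-sym y₂ x₂)))

Forbidden : Set
Forbidden = ℕ → Bool

none : Forbidden
none _ = false

_⊕_ : Forbidden → Dimer → Forbidden
(F ⊕ d) x = F x ∨ covers d x

avoids : Forbidden → Dimer → Bool
avoids F d = not (F (proj₁ d)) ∧ not (F (proj₂ d))

avoids-⊕ : ∀ F x y → avoids (F ⊕ x) y ≡ avoids F y ∧ disjoint y x
avoids-⊕ F x (y₁ , y₂) = begin
  not (F y₁ ∨ covers x y₁) ∧ not (F y₂ ∨ covers x y₂)
    ≡⟨ cong₂ _∧_ (deMorgan₂ (F y₁) (covers x y₁)) (deMorgan₂ (F y₂) (covers x y₂)) ⟩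
  (not (F y₁) ∧ not (covers x y₁)) ∧ (not (F y₂) ∧ not (covers x y₂))
    ≡⟨ ∧-interchange (not (F y₁)) (not (covers x y₁)) (not (F y₂)) (not (covers x y₂)) ⟩
  (not (F y₁) ∧ not (F y₂)) ∧ (not (covers x y₁) ∧ not (covers x y₂))
    ∎
  where open ≡-Reasoning

⊕-comm : ∀ F x y → (F ⊕ x) ⊕ y ≗ (F ⊕ y) ⊕ x
⊕-comm F x y h = ∨-assoc-comm (F h) (covers x h) (covers y h)
  where
  ∨-assoc-comm : ∀ a b c → (a ∨ b) ∨ c ≡ (a ∨ c) ∨ b
  ∨-assoc-comm true  b c = refl
  ∨-assoc-comm false b c = ∨-comm b c

avoids-false₁ : ∀ F d → F (proj₁ d) ≡ true → avoids F d ≡ false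
avoids-false₁ F d Fd rewrite Fd = refl

avoids-false₂ : ∀ F d → F (proj₂ d) ≡ true → avoids F d ≡ false
avoids-false₂ F d Fd rewrite Fd = ∧-zeroʳ _

-- The number of k-element sets of pairwise disjoint dimers of L avoiding every hexagon in F.
matchings : List Dimer → Forbidden → ℕ → ℕ
matchings []      F zero    = 1
matchings []      F (suc k) = 0
matchings (d ∷ L) F zero    = matchings L F zero
matchings (d ∷ L) F (suc k) = (if avoids F d then matchings L (F ⊕ d) k else 0) + matchings L F (suc k)

matchings-zero : ∀ L F → matchings L F 0 ≡ 1
matchings-zero []      F = refl
matchings-zero (d ∷ L) F = matchings-zero L F

BothEnds : (ℕ → Set) → Dimer → Set
BothEnds P d = P (proj₁ d) × P (proj₂ d)

matchings-cong-on : ∀ (P : ℕ → Set) L {F G} k → All (BothEnds P) L → (∀ {x} → P x → F x ≡ G x) →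
                    matchings L F k ≡ matchings L G k
matchings-cong-on P []      zero    _ _ = refl
matchings-cong-on P []      (suc k) _ _ = refl
matchings-cong-on P (d ∷ L) zero    (_ ∷ ends) F≡G = matchings-cong-on P L zero ends F≡G
matchings-cong-on P (d ∷ L) (suc k) ((p₁ , p₂) ∷ ends) F≡G =
  cong₂ _+_ (cong₂ (λ b m → if b then m else 0)
                   (cong₂ (λ a b → not a ∧ not b) (F≡G p₁) (F≡G p₂))
                   (matchings-cong-on P L k ends (λ p → cong (_∨ covers d _) (F≡G p))))
            (matchings-cong-on P L (suc k) ends F≡G)

matchings-cong : ∀ L {F G} k → F ≗ G → matchings L F k ≡ matchings L G k
matchings-cong L k F≗G = matchings-cong-on (λ _ → ⊤) L k (All.universal (λ _ → tt , tt) L) (λ {x} _ → F≗G x)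

matchings-swap : ∀ x y L F k → matchings (x ∷ y ∷ L) F k ≡ matchings (y ∷ x ∷ L) F k
matchings-swap x y L F zero          = refl
matchings-swap x y L F (suc zero)    =
  x∙yz≈y∙xz (if avoids F x then matchings L (F ⊕ x) 0 else 0)
            (if avoids F y then matchings L (F ⊕ y) 0 else 0) (matchings L F 1)
matchings-swap x y L F (suc (suc k))
  rewrite avoids-⊕ F x y | avoids-⊕ F y x | disjoint-sym x y
        | matchings-cong L k (⊕-comm F y x)
  = if-swap (avoids F x) (avoids F y) (disjoint y x) (matchings L ((F ⊕ x) ⊕ y) k) _ _ _
  where
  if-swap : ∀ (p q r : Bool) (a b b′ c : ℕ) →
    (if p then (if q ∧ r then a else 0) + b else 0) + ((if q then b′ else 0) + c)
    ≡ (if q then (if p ∧ r then a else 0) + b′ else 0) + ((if p then b else 0) + c)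
  if-swap false q     r a b b′ c = refl
  if-swap true  false r a b b′ c = refl
  if-swap true  true  r a b b′ c = ring (if r then a else 0) b b′ c
    where
    ring : ∀ a b b′ c → a + b + (b′ + c) ≡ a + b′ + (b + c)
    ring = solve-∀

matchings-∷ : ∀ x {L L′} → (∀ F k → matchings L F k ≡ matchings L′ F k) →
              ∀ F k → matchings (x ∷ L) F k ≡ matchings (x ∷ L′) F k
matchings-∷ x L≡L′ F zero    = L≡L′ F zero
matchings-∷ x L≡L′ F (suc k) =
  cong₂ _+_ (cong (λ m → if avoids F x then m else 0) (L≡L′ (F ⊕ x) k)) (L≡L′ F (suc k))

matchings-↭ : ∀ {L L′} → L ↭ L′ → ∀ F k → matchings L F k ≡ matchings L′ F k
matchings-↭ ↭.refl          F k = refl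
matchings-↭ (↭.prep x L↭L′) = matchings-∷ x (matchings-↭ L↭L′)
matchings-↭ (↭.swap x y L↭L′) F k =
  trans (matchings-swap x y _ F k) (matchings-∷ y (matchings-∷ x (matchings-↭ L↭L′)) F k)
matchings-↭ (↭.trans L↭M M↭L′) F k = trans (matchings-↭ L↭M F k) (matchings-↭ M↭L′ F k)

matchings-skip : ∀ d L F k → avoids F d ≡ false → matchings (d ∷ L) F k ≡ matchings L F k
matchings-skip d L F zero    _       = refl
matchings-skip d L F (suc k) blocked rewrite blocked = refl

matchings-skip-++ : ∀ B L F k → All (λ d → avoids F d ≡ false) B → matchings (B ++ L) F k ≡ matchings L F k
matchings-skip-++ []      L F k []                 = refl
matchings-skip-++ (d ∷ B) L F k (blocked ∷ blocks) =
  trans (matchings-skip d (B ++ L) F k blocked) (matchings-skip-++ B L F k blocks)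

dimersEndingAt : ℕ → List Dimer
dimersEndingAt zero          = []
dimersEndingAt (suc zero)    = (0 , 1) ∷ []
dimersEndingAt (suc (suc t)) = (suc t , suc (suc t)) ∷ (t , suc (suc t)) ∷ []

dimersEndingAt-top : ∀ t → All (λ d → proj₂ d ≡ t) (dimersEndingAt t)
dimersEndingAt-top zero          = []
dimersEndingAt-top (suc zero)    = refl ∷ []
dimersEndingAt-top (suc (suc t)) = refl ∷ refl ∷ []

map-upTo-suc : ∀ {A : Set} (f : ℕ → A) n → map f (upTo (suc n)) ≡ map f (upTo n) ∷ʳ f n
map-upTo-suc f n =
  trans (map-upTo f (suc n)) (trans (sym (applyUpTo-∷ʳ f n)) (cong (_∷ʳ f n) (sym (map-upTo f n))))

dimers-suc-↭ : ∀ t → dimers (suc t) ↭ dimersEndingAt t ++ dimers t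
dimers-suc-↭ zero          = ↭.refl
dimers-suc-↭ (suc zero)    = ↭.refl
dimers-suc-↭ (suc (suc t)) = begin
  dimers (3 + t)             ≡⟨ dimers-3+t ⟩
  S ++ (a ∷ (H ++ b ∷ []))   ↭⟨ shift a S (H ++ b ∷ []) ⟩
  a ∷ (S ++ (H ++ b ∷ []))   ≡⟨ cong (a ∷_) (++-assoc S H (b ∷ [])) ⟨
  a ∷ ((S ++ H) ++ b ∷ [])   ↭⟨ ↭.prep a (++-comm (S ++ H) (b ∷ [])) ⟩
  a ∷ b ∷ (S ++ H)           ∎
  where
  open PermutationReasoning
  S = map (λ i → (i , suc i)) (upTo (suc t))
  H = map (λ i → (i , suc (suc i))) (upTo t)
  a b : Dimer
  a = (suc t , suc (suc t))
  b = (t , suc (suc t))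
  dimers-3+t : dimers (3 + t) ≡ S ++ (a ∷ (H ++ b ∷ []))
  dimers-3+t = trans (cong₂ _++_ (map-upTo-suc (λ i → (i , suc i)) (suc t)) (map-upTo-suc (λ i → (i , suc (suc i))) t))
                     (++-assoc S (a ∷ []) (H ++ b ∷ []))

Inside : ℕ → Dimer → Set
Inside n d = proj₁ d < proj₂ d × proj₂ d < n

dimers-inside : ∀ n → All (Inside n) (dimers n)
dimers-inside zero    = []
dimers-inside (suc n) =
  ++⁺ (map⁺ (applyUpTo⁺₁ (λ x → x) n (λ {i} i<n → n<1+n i , s≤s i<n))) (horizontal n)
  where
  horizontal : ∀ n → All (Inside (suc n)) (map (λ i → (i , suc (suc i))) (upTo (n ∸ 1)))
  horizontal zero    = []
  horizontal (suc n) = map⁺ (applyUpTo⁺₁ (λ x → x) n (λ {i} i<n → ≤-trans (n<1+n i) (n≤1+n _) , s≤s (s≤s i<n)))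

matchings-forbidden-top : ∀ t F k → F t ≡ true → matchings (dimers (suc t)) F k ≡ matchings (dimers t) F k
matchings-forbidden-top t F k Ft =
  trans (matchings-↭ (dimers-suc-↭ t) F k)
        (matchings-skip-++ (dimersEndingAt t) (dimers t) F k (All.map blocked (dimersEndingAt-top t)))
  where
  blocked : ∀ {d} → proj₂ d ≡ t → avoids F d ≡ false
  blocked {d} refl = avoids-false₂ F d Ft

matchingCount : ℕ → ℕ → ℕ
matchingCount n k = matchings (dimers n) none k

matchings-free : ∀ n F k → (∀ x → x < n → F x ≡ false) → matchings (dimers n) F k ≡ matchingCount n k
matchings-free n F k free =
  matchings-cong-on (_< n) (dimers n) k (All.map (λ (i<j , j<n) → <-trans i<j j<n , j<n) (dimers-inside n)) (free _)

covers-below : ∀ p q {x} → x < p → p ≤ q → covers (p , q) x ≡ false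
covers-below p q x<p p≤q rewrite >⇒≡ᵇ-false x<p | >⇒≡ᵇ-false (<-≤-trans x<p p≤q) = refl

matchings-after-slanted : ∀ N k →
  matchings ((1 + N , 3 + N) ∷ dimers (3 + N)) (none ⊕ (2 + N , 3 + N)) k ≡ matchingCount (2 + N) k
matchings-after-slanted N k = begin
  matchings ((1 + N , 3 + N) ∷ dimers (3 + N)) F k
    ≡⟨ matchings-skip (1 + N , 3 + N) (dimers (3 + N)) F k (avoids-false₂ F (1 + N , 3 + N) F[3+N]) ⟩
  matchings (dimers (3 + N)) F k
    ≡⟨ matchings-forbidden-top (2 + N) F k F[2+N] ⟩
  matchings (dimers (2 + N)) F k
    ≡⟨ matchings-free (2 + N) F k (λ x x<2+N → covers-below (2 + N) (3 + N) x<2+N (n≤1+n _)) ⟩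
  matchingCount (2 + N) k
    ∎
  where
  open ≡-Reasoning
  F = none ⊕ (2 + N , 3 + N)
  F[2+N] : F (2 + N) ≡ true
  F[2+N] rewrite ≡ᵇ-refl N = refl
  F[3+N] : F (3 + N) ≡ true
  F[3+N] rewrite ≡ᵇ-refl N = ∨-zeroʳ _

matchings-after-horizontal : ∀ N k →
  matchings (dimers (3 + N)) (none ⊕ (1 + N , 3 + N)) (suc k) ≡ matchingCount N k + matchingCount (1 + N) (suc k)
matchings-after-horizontal N k = begin
  matchings (dimers (3 + N)) F (suc k)
    ≡⟨ matchings-↭ (dimers-suc-↭ (2 + N)) F (suc k) ⟩
  matchings ((1 + N , 2 + N) ∷ (N , 2 + N) ∷ dimers (2 + N)) F (suc k)
    ≡⟨ matchings-skip (1 + N , 2 + N) ((N , 2 + N) ∷ dimers (2 + N)) F (suc k) (avoids-false₁ F (1 + N , 2 + N) F[1+N]) ⟩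
  matchings ((N , 2 + N) ∷ dimers (2 + N)) F (suc k)
    ≡⟨ cong (λ b → (if b then matchings (dimers (2 + N)) F′ k else 0) + matchings (dimers (2 + N)) F (suc k)) F-avoids ⟩
  matchings (dimers (2 + N)) F′ k + matchings (dimers (2 + N)) F (suc k)
    ≡⟨ cong₂ _+_ (trans (matchings-forbidden-top (1 + N) F′ k (cong (_∨ covers (N , 2 + N) (1 + N)) F[1+N]))
                 (trans (matchings-forbidden-top N F′ k F′[N]) (matchings-free N F′ k F′-free)))
                 (trans (matchings-forbidden-top (1 + N) F (suc k) F[1+N]) (matchings-free (1 + N) F (suc k) F-free)) ⟩
  matchingCount N k + matchingCount (1 + N) (suc k)
    ∎
  where
  open ≡-Reasoning
  F F′ : Forbidden
  F  = none ⊕ (1 + N , 3 + N)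
  F′ = F ⊕ (N , 2 + N)
  F[1+N] : F (1 + N) ≡ true
  F[1+N] rewrite ≡ᵇ-refl N = refl
  F′[N] : F′ N ≡ true
  F′[N] rewrite ≡ᵇ-refl N = ∨-zeroʳ _
  F-free : ∀ x → x < 1 + N → F x ≡ false
  F-free x x<1+N = covers-below (1 + N) (3 + N) x<1+N (m≤n+m (1 + N) 2)
  F′-free : ∀ x → x < N → F′ x ≡ false
  F′-free x x<N = cong₂ _∨_ (F-free x (<-trans x<N (n<1+n N))) (covers-below N (2 + N) x<N (m≤n+m N 2))
  F-avoids : avoids F (N , 2 + N) ≡ true
  F-avoids rewrite F-free N (n<1+n N) | <⇒≡ᵇ-false (n<1+n (1 + N)) | >⇒≡ᵇ-false (n<1+n (2 + N)) = refl

matchingCount-suc : ∀ N k → matchingCount (4 + N) (suc k)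
  ≡ matchingCount (2 + N) k + (matchings (dimers (3 + N)) (none ⊕ (1 + N , 3 + N)) k + matchingCount (3 + N) (suc k))
matchingCount-suc N k =
  trans (matchings-↭ (dimers-suc-↭ (3 + N)) none (suc k))
        (cong (_+ matchings ((1 + N , 3 + N) ∷ dimers (3 + N)) none (suc k)) (matchings-after-slanted N k))

matchingCount-rec₁ : ∀ N →
  matchingCount (4 + N) 1 ≡ matchingCount (3 + N) 1 + matchingCount (2 + N) 0 + matchingCount (1 + N) 0
matchingCount-rec₁ N
  rewrite matchingCount-suc N 0
        | matchings-zero (dimers (3 + N)) (none ⊕ (1 + N , 3 + N))
        | matchings-zero (dimers (2 + N)) none
        | matchings-zero (dimers (1 + N)) none
  = ring (matchingCount (3 + N) 1)
  where
  ring : ∀ x → 1 + (1 + x) ≡ x + 1 + 1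
  ring = solve-∀

matchingCount-rec₂ : ∀ N k →
  matchingCount (4 + N) (2 + k)
  ≡ matchingCount (3 + N) (2 + k) + matchingCount (2 + N) (1 + k) + matchingCount (1 + N) (1 + k) + matchingCount N k
matchingCount-rec₂ N k rewrite matchingCount-suc N (suc k) | matchings-after-horizontal N k =
  ring (matchingCount (2 + N) (1 + k)) (matchingCount N k) (matchingCount (1 + N) (1 + k)) (matchingCount (3 + N) (2 + k))
  where
  ring : ∀ a b c d → a + ((b + c) + d) ≡ d + a + c + b
  ring = solve-∀

matchingCount≡binomialCount : ∀ n k → matchingCount n k ≡ binomialCount n k
matchingCount≡binomialCount 0 0 = refl
matchingCount≡binomialCount 0 1 = refl
matchingCount≡binomialCount 0 2 = refl
matchingCount≡binomialCount 0 3 = refl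
matchingCount≡binomialCount 1 0 = refl
matchingCount≡binomialCount 1 1 = refl
matchingCount≡binomialCount 1 2 = refl
matchingCount≡binomialCount 1 3 = refl
matchingCount≡binomialCount 2 0 = refl
matchingCount≡binomialCount 2 1 = refl
matchingCount≡binomialCount 2 2 = refl
matchingCount≡binomialCount 2 3 = refl
matchingCount≡binomialCount 3 0 = refl
matchingCount≡binomialCount 3 1 = refl
matchingCount≡binomialCount 3 2 = refl
matchingCount≡binomialCount 3 3 = refl
matchingCount≡binomialCount 0 (suc (suc (suc (suc k)))) = sym (binomialCount-vanishes 0 (3 + k) z≤n)
matchingCount≡binomialCount 1 (suc (suc (suc (suc k)))) = sym (binomialCount-vanishes 1 (3 + k) (s≤s z≤n))
matchingCount≡binomialCount 2 (suc (suc (suc (suc k)))) = sym (binomialCount-vanishes 2 (3 + k) (s≤s (s≤s z≤n)))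
matchingCount≡binomialCount 3 (suc (suc (suc (suc k)))) = sym (binomialCount-vanishes 3 (3 + k) (s≤s (s≤s (s≤s z≤n))))
matchingCount≡binomialCount (suc (suc (suc (suc N)))) 0 = matchings-zero (dimers (4 + N)) none
matchingCount≡binomialCount (suc (suc (suc (suc N)))) 1 = begin
  matchingCount (4 + N) 1
    ≡⟨ matchingCount-rec₁ N ⟩
  matchingCount (3 + N) 1 + matchingCount (2 + N) 0 + matchingCount (1 + N) 0
    ≡⟨ cong₂ _+_ (cong₂ _+_ (matchingCount≡binomialCount (suc (suc (suc N))) 1)
                            (matchingCount≡binomialCount (suc (suc N)) 0))
                 (matchingCount≡binomialCount (suc N) 0) ⟩
  binomialCount (3 + N) 1 + binomialCount (2 + N) 0 + binomialCount (1 + N) 0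
    ≡⟨ binomialCount-rec₁ N ⟨
  binomialCount (4 + N) 1
    ∎
  where open ≡-Reasoning
matchingCount≡binomialCount (suc (suc (suc (suc N)))) (suc (suc k)) = begin
  matchingCount (4 + N) (2 + k)
    ≡⟨ matchingCount-rec₂ N k ⟩
  matchingCount (3 + N) (2 + k) + matchingCount (2 + N) (1 + k) + matchingCount (1 + N) (1 + k) + matchingCount N k
    ≡⟨ cong₂ _+_ (cong₂ _+_ (cong₂ _+_ (matchingCount≡binomialCount (suc (suc (suc N))) (suc (suc k)))
                                       (matchingCount≡binomialCount (suc (suc N)) (1 + k)))
                            (matchingCount≡binomialCount (suc N) (1 + k)))
                 (matchingCount≡binomialCount N k) ⟩
  binomialCount (3 + N) (2 + k) + binomialCount (2 + N) (1 + k) + binomialCount (1 + N) (1 + k) + binomialCount N k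
    ≡⟨ binomialCount-rec₂ N k ⟨
  binomialCount (4 + N) (2 + k)
    ∎
  where open ≡-Reasoning

-- Tilings, monomers and colourings

countᵇ : {A : Set} → (A → Bool) → List A → ℕ
countᵇ p []       = 0
countᵇ p (x ∷ xs) = (if p x then 1 else 0) + countᵇ p xs

length-filter≡countᵇ : ∀ {A : Set} {P : Pred A 0ℓ} (P? : Decidable P) xs →
                        length (filter P? xs) ≡ countᵇ (does ∘ P?) xs
length-filter≡countᵇ P? []       = refl
length-filter≡countᵇ P? (x ∷ xs) with does (P? x)
... | true  = cong suc (length-filter≡countᵇ P? xs)
... | false = length-filter≡countᵇ P? xs

countᵇ-filter : ∀ {A : Set} {P : Pred A 0ℓ} (P? : Decidable P) q xs →
                countᵇ q (filter P? xs) ≡ countᵇ (λ x → does (P? x) ∧ q x) xs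
countᵇ-filter P? q []       = refl
countᵇ-filter P? q (x ∷ xs) with does (P? x)
... | true  = cong ((if q x then 1 else 0) +_) (countᵇ-filter P? q xs)
... | false = countᵇ-filter P? q xs

countᵇ-cong : ∀ {A : Set} {p q : A → Bool} → p ≗ q → ∀ xs → countᵇ p xs ≡ countᵇ q xs
countᵇ-cong p≗q []       = refl
countᵇ-cong p≗q (x ∷ xs) = cong₂ _+_ (cong (λ b → if b then 1 else 0) (p≗q x)) (countᵇ-cong p≗q xs)

countᵇ-++ : ∀ {A : Set} (p : A → Bool) xs ys → countᵇ p (xs ++ ys) ≡ countᵇ p xs + countᵇ p ys
countᵇ-++ p []       ys = refl
countᵇ-++ p (x ∷ xs) ys =
  trans (cong ((if p x then 1 else 0) +_) (countᵇ-++ p xs ys)) (sym (+-assoc (if p x then 1 else 0) _ _))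

countᵇ-map : ∀ {A B : Set} (p : B → Bool) (f : A → B) xs → countᵇ p (map f xs) ≡ countᵇ (p ∘ f) xs
countᵇ-map p f []       = refl
countᵇ-map p f (x ∷ xs) = cong ((if p (f x) then 1 else 0) +_) (countᵇ-map p f xs)

countᵇ-none : ∀ {A : Set} (p : A → Bool) {xs} → All (λ x → p x ≡ false) xs → countᵇ p xs ≡ 0
countᵇ-none p []               = refl
countᵇ-none p (px≡false ∷ pxs) rewrite px≡false = countᵇ-none p pxs

countᵇ-true : ∀ {A : Set} (xs : List A) → countᵇ (λ _ → true) xs ≡ length xs
countᵇ-true []       = refl
countᵇ-true (x ∷ xs) = cong suc (countᵇ-true xs)

countᵇ-split : ∀ {A : Set} (p q : A → Bool) xs →
               countᵇ p xs ≡ countᵇ (λ x → p x ∧ q x) xs + countᵇ (λ x → p x ∧ not (q x)) xs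
countᵇ-split p q []       = refl
countᵇ-split p q (x ∷ xs) with p x | q x
... | false | _     = countᵇ-split p q xs
... | true  | true  = cong suc (countᵇ-split p q xs)
... | true  | false = trans (cong suc (countᵇ-split p q xs)) (sym (+-suc _ _))

all-cong : ∀ {A : Set} {p q : A → Bool} → p ≗ q → ∀ xs → all p xs ≡ all q xs
all-cong p≗q xs = cong and (map-cong p≗q xs)

all-∧ : ∀ {A : Set} (p q : A → Bool) xs → all (λ x → p x ∧ q x) xs ≡ all p xs ∧ all q xs
all-∧ p q []       = refl
all-∧ p q (x ∷ xs) = trans (cong ((p x ∧ q x) ∧_) (all-∧ p q xs)) (∧-interchange (p x) (q x) (all p xs) (all q xs))

all-avoids-⊕ : ∀ F x s → all (avoids (F ⊕ x)) s ≡ all (avoids F) s ∧ all (disjoint x) s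
all-avoids-⊕ F x s =
  trans (all-cong (λ d → trans (avoids-⊕ F x d) (cong (avoids F d ∧_) (disjoint-sym d x))) s)
        (all-∧ (avoids F) (disjoint x) s)

all-avoids-none : ∀ s → all (avoids none) s ≡ true
all-avoids-none []      = refl
all-avoids-none (d ∷ s) = all-avoids-none s

isMatching : Forbidden → ℕ → List Dimer → Bool
isMatching F k s = pairwiseDisjoint s ∧ (all (avoids F) s ∧ (length s ≡ᵇ k))

countᵇ-isMatching-sublists : ∀ L F k → countᵇ (isMatching F k) (sublists L) ≡ matchings L F k
countᵇ-isMatching-sublists []      F zero    = refl
countᵇ-isMatching-sublists []      F (suc k) = refl
countᵇ-isMatching-sublists (x ∷ L) F k =
  trans (countᵇ-++ (isMatching F k) (map (x ∷_) (sublists L)) (sublists L))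
        (trans (cong (_+ countᵇ (isMatching F k) (sublists L)) (countᵇ-map (isMatching F k) (x ∷_) (sublists L)))
               (with-or-without-x k))
  where
  reorder : ∀ a p b l → (a ∧ p) ∧ (b ∧ l) ≡ p ∧ ((b ∧ a) ∧ l)
  reorder true  true  b l = cong (_∧ l) (sym (∧-identityʳ b))
  reorder true  false b l = refl
  reorder false true  b l = cong (_∧ l) (sym (∧-zeroʳ b))
  reorder false false b l = refl
  with-or-without-x : ∀ k → countᵇ (isMatching F k ∘ (x ∷_)) (sublists L) + countᵇ (isMatching F k) (sublists L)
                          ≡ matchings (x ∷ L) F k
  with-or-without-x zero =
    cong₂ _+_ (countᵇ-none _ (All.universal (λ s → trans (cong (pairwiseDisjoint (x ∷ s) ∧_) (∧-zeroʳ _)) (∧-zeroʳ _))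
                                            (sublists L)))
              (countᵇ-isMatching-sublists L F zero)
  with-or-without-x (suc k) with avoids F x
  ... | false = cong₂ _+_ (countᵇ-none _ (All.universal (λ s → ∧-zeroʳ _) (sublists L)))
                          (countᵇ-isMatching-sublists L F (suc k))
  ... | true  = cong₂ _+_
    (trans (countᵇ-cong (λ s → trans (reorder (all (disjoint x) s) (pairwiseDisjoint s) (all (avoids F) s) (length s ≡ᵇ k))
                                     (cong (λ b → pairwiseDisjoint s ∧ (b ∧ (length s ≡ᵇ k))) (sym (all-avoids-⊕ F x s))))
                        (sublists L))
           (countᵇ-isMatching-sublists L (F ⊕ x) k))
    (countᵇ-isMatching-sublists L F (suc k))

does-≟-true : ∀ b → does (b Bool.≟ true) ≡ b
does-≟-true true  = refl
does-≟-true false = refl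

c≡matchingCount : ∀ n k → c n k ≡ matchingCount n k
c≡matchingCount n k = begin
  c n k
    ≡⟨ length-filter≡countᵇ _ (tilings n) ⟩
  countᵇ (λ s → length s ≡ᵇ k) (tilings n)
    ≡⟨ countᵇ-filter _ (λ s → length s ≡ᵇ k) (sublists (dimers n)) ⟩
  countᵇ (λ s → does (pairwiseDisjoint s Bool.≟ true) ∧ (length s ≡ᵇ k)) (sublists (dimers n))
    ≡⟨ countᵇ-cong (λ s → cong₂ (λ p a → p ∧ (a ∧ (length s ≡ᵇ k)))
                                (does-≟-true (pairwiseDisjoint s)) (sym (all-avoids-none s)))
                   (sublists (dimers n)) ⟩
  countᵇ (isMatching none k) (sublists (dimers n))
    ≡⟨ countᵇ-isMatching-sublists (dimers n) none k ⟩
  matchingCount n k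
    ∎
  where open ≡-Reasoning

uncovered : List Dimer → ℕ → Bool
uncovered ds x = not (any (λ d → covers d x) ds)

does-≟-false : ∀ b → does (b Bool.≟ false) ≡ not b
does-≟-false true  = refl
does-≟-false false = refl

length-monomers : ∀ n ds → length (monomers n ds) ≡ countᵇ (uncovered ds) (upTo n)
length-monomers n ds =
  trans (length-filter≡countᵇ _ (upTo n)) (countᵇ-cong (λ x → does-≟-false (any (λ d → covers d x) ds)) (upTo n))

countᵇ-upTo-suc : ∀ (p : ℕ → Bool) n → countᵇ p (upTo (suc n)) ≡ countᵇ p (upTo n) + (if p n then 1 else 0)
countᵇ-upTo-suc p n =
  trans (cong (countᵇ p) (sym (upTo-∷ʳ n)))
        (trans (countᵇ-++ p (upTo n) (n ∷ [])) (cong (countᵇ p (upTo n) +_) (+-identityʳ _)))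

countᵇ-≡ᵇ-upTo : ∀ n i → i < n → countᵇ (i ≡ᵇ_) (upTo n) ≡ 1
countᵇ-≡ᵇ-upTo (suc n) i (s≤s i≤n) with i ≟ n
... | yes refl rewrite countᵇ-upTo-suc (i ≡ᵇ_) i | ≡ᵇ-refl i =
  cong (_+ 1) (countᵇ-none (i ≡ᵇ_) (All.map >⇒≡ᵇ-false (all-upTo i)))
... | no  i≢n  rewrite countᵇ-upTo-suc (i ≡ᵇ_) n | <⇒≡ᵇ-false (≤∧≢⇒< i≤n i≢n) =
  trans (+-identityʳ _) (countᵇ-≡ᵇ-upTo n i (≤∧≢⇒< i≤n i≢n))

countᵇ-covers : ∀ n d → Inside n d → countᵇ (covers d) (upTo n) ≡ 2
countᵇ-covers n (i , j) (i<j , j<n) =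
  trans (countᵇ-split (covers (i , j)) (i ≡ᵇ_) (upTo n))
        (cong₂ _+_ (trans (countᵇ-cong at-i (upTo n)) (countᵇ-≡ᵇ-upTo n i (<-trans i<j j<n)))
                   (trans (countᵇ-cong at-j (upTo n)) (countᵇ-≡ᵇ-upTo n j j<n)))
  where
  at-i : ∀ x → covers (i , j) x ∧ (i ≡ᵇ x) ≡ (i ≡ᵇ x)
  at-i x with i ≡ᵇ x
  ... | true  = refl
  ... | false = ∧-zeroʳ _
  at-j : ∀ x → covers (i , j) x ∧ not (i ≡ᵇ x) ≡ (j ≡ᵇ x)
  at-j x with i ≡ᵇ x in i≡ᵇx
  ... | true  = sym (trans (cong (j ≡ᵇ_) (sym (≡ᵇ-true⇒≡ i x i≡ᵇx))) (>⇒≡ᵇ-false i<j))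
  ... | false = ∧-identityʳ _

∧≡true : ∀ a b → a ∧ b ≡ true → a ≡ true × b ≡ true
∧≡true true true refl = refl , refl

uncovered-∷ : ∀ d ds x → uncovered (d ∷ ds) x ≡ not (covers d x) ∧ uncovered ds x
uncovered-∷ d ds x = deMorgan₂ (covers d x) (any (λ d′ → covers d′ x) ds)

uncovered≡all : ∀ ds x → uncovered ds x ≡ all (λ d → not (covers d x)) ds
uncovered≡all []       x = refl
uncovered≡all (d ∷ ds) x = trans (uncovered-∷ d ds x) (cong (not (covers d x) ∧_) (uncovered≡all ds x))

all-disjoint≡uncovered : ∀ d ds → all (disjoint d) ds ≡ uncovered ds (proj₁ d) ∧ uncovered ds (proj₂ d)
all-disjoint≡uncovered d ds =
  trans (all-∧ (λ d′ → not (covers d′ (proj₁ d))) (λ d′ → not (covers d′ (proj₂ d))) ds)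
        (sym (cong₂ _∧_ (uncovered≡all ds (proj₁ d)) (uncovered≡all ds (proj₂ d))))

uncovered-covers : ∀ i j ds → uncovered ds i ≡ true → uncovered ds j ≡ true →
                   ∀ x → uncovered ds x ∧ covers (i , j) x ≡ covers (i , j) x
uncovered-covers i j ds uᵢ uⱼ x with i ≡ᵇ x in i≡ᵇx | j ≡ᵇ x in j≡ᵇx
... | true  | _     with refl ← ≡ᵇ-true⇒≡ i x i≡ᵇx = trans (∧-identityʳ _) uᵢ
... | false | true  with refl ← ≡ᵇ-true⇒≡ j x j≡ᵇx = trans (∧-identityʳ _) uⱼ
... | false | false = ∧-zeroʳ _

countᵇ-uncovered : ∀ n ds → All (Inside n) ds → pairwiseDisjoint ds ≡ true →
                   countᵇ (uncovered ds) (upTo n) + 2 * length ds ≡ n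
countᵇ-uncovered n []       _ _ = trans (+-identityʳ _) (trans (countᵇ-true (upTo n)) (length-upTo n))
countᵇ-uncovered n (d ∷ ds) (inside ∷ insides) disjoint-all
  with ∧≡true (all (disjoint d) ds) (pairwiseDisjoint ds) disjoint-all
... | d-disjoint , ds-disjoint = begin
  countᵇ (uncovered (d ∷ ds)) (upTo n) + 2 * suc (length ds)  ≡⟨ ring (countᵇ (uncovered (d ∷ ds)) (upTo n)) (length ds) ⟩
  2 + countᵇ (uncovered (d ∷ ds)) (upTo n) + 2 * length ds    ≡⟨ cong (_+ 2 * length ds) remove-d ⟨
  countᵇ (uncovered ds) (upTo n) + 2 * length ds              ≡⟨ countᵇ-uncovered n ds insides ds-disjoint ⟩
  n                                                           ∎
  where
  open ≡-Reasoning
  ring : ∀ u l → u + 2 * suc l ≡ 2 + u + 2 * l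
  ring = solve-∀
  ends = ∧≡true _ _ (trans (sym (all-disjoint≡uncovered d ds)) d-disjoint)
  remove-d : countᵇ (uncovered ds) (upTo n) ≡ 2 + countᵇ (uncovered (d ∷ ds)) (upTo n)
  remove-d = trans (countᵇ-split (uncovered ds) (covers d) (upTo n))
    (cong₂ _+_ (trans (countᵇ-cong (uncovered-covers (proj₁ d) (proj₂ d) ds (proj₁ ends) (proj₂ ends)) (upTo n))
                      (countᵇ-covers n d inside))
               (countᵇ-cong (λ x → trans (∧-comm (uncovered ds x) (not (covers d x))) (sym (uncovered-∷ d ds x))) (upTo n)))

length-concatMap : ∀ {A B : Set} (f : A → List B) xs → length (concatMap f xs) ≡ sum (map (length ∘ f) xs)
length-concatMap f []       = refl
length-concatMap f (x ∷ xs) = trans (length-++ (f x)) (cong (length (f x) +_) (length-concatMap f xs))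

sum-map-cong-All : ∀ {A : Set} {P : A → Set} (f g : A → ℕ) → (∀ {x} → P x → f x ≡ g x) →
                   ∀ {xs} → All P xs → sum (map f xs) ≡ sum (map g xs)
sum-map-cong-All f g f≡g []         = refl
sum-map-cong-All f g f≡g (px ∷ pxs) = cong₂ _+_ (f≡g px) (sum-map-cong-All f g f≡g pxs)

sum-map-const : ∀ {A : Set} m (xs : List A) → sum (map (λ _ → m) xs) ≡ length xs * m
sum-map-const m []       = refl
sum-map-const m (x ∷ xs) = cong (m +_) (sum-map-const m xs)

sum-map-length : ∀ {A B : Set} m (f : A → List B) xs → (∀ x → length (f x) ≡ m) →
                 length (concatMap f xs) ≡ length xs * m
sum-map-length m f xs len-f =
  trans (length-concatMap f xs) (trans (cong sum (map-cong len-f xs)) (sum-map-const m xs))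

length-allVecs : ∀ a m → length (allVecs a m) ≡ a ^ m
length-allVecs a zero    = refl
length-allVecs a (suc m) = begin
  length (allVecs a (suc m))
    ≡⟨ sum-map-length a _ (allVecs a m) (λ v → trans (length-map _ (allFin a)) (length-tabulate (λ i → i))) ⟩
  length (allVecs a m) * a
    ≡⟨ cong (_* a) (length-allVecs a m) ⟩
  a ^ m * a
    ≡⟨ *-comm (a ^ m) a ⟩
  a ^ suc m
    ∎
  where open ≡-Reasoning

h≡sum-tilings : ∀ a b n → h a b n ≡ sum (map (λ ds → a ^ length (monomers n ds) * b ^ length ds) (tilings n))
h≡sum-tilings a b n = trans (length-concatMap _ (tilings n)) (cong sum (map-cong colourings (tilings n)))
  where
  colourings : ∀ ds → length (concatMap (λ u → map (λ v → (ds , length (monomers n ds) , u , v)) (allVecs b (length ds)))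
                                        (allVecs a (length (monomers n ds))))
                    ≡ a ^ length (monomers n ds) * b ^ length ds
  colourings ds =
    trans (sum-map-length (b ^ length ds) _ (allVecs a (length (monomers n ds)))
                          (λ u → trans (length-map _ (allVecs b (length ds))) (length-allVecs b (length ds))))
          (cong (_* b ^ length ds) (length-allVecs a (length (monomers n ds))))

sublists-All : ∀ {A : Set} {P : A → Set} {L} → All P L → All (All P) (sublists L)
sublists-All []         = [] ∷ []
sublists-All (px ∷ pxs) = ++⁺ (map⁺ (All.map (px ∷_) (sublists-All pxs))) (sublists-All pxs)

IsTiling : ℕ → List Dimer → Set
IsTiling n ds = All (Inside n) ds × pairwiseDisjoint ds ≡ true

tilings-IsTiling : ∀ n → All (IsTiling n) (tilings n)
tilings-IsTiling n =
  All.zip (filter⁺ pd? (sublists-All (dimers-inside n)) , all-filter pd? (sublists (dimers n)))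
  where
  pd? : Decidable (λ ds → pairwiseDisjoint ds ≡ true)
  pd? ds = pairwiseDisjoint ds Bool.≟ true

length-monomers-tiling : ∀ n ds → IsTiling n ds → length (monomers n ds) ≡ n ∸ 2 * length ds
length-monomers-tiling n ds (inside , disjoint-all) = begin
  length (monomers n ds)                                     ≡⟨ length-monomers n ds ⟩
  countᵇ (uncovered ds) (upTo n)                             ≡⟨ m+n∸n≡m _ (2 * length ds) ⟨
  countᵇ (uncovered ds) (upTo n) + 2 * length ds ∸ 2 * length ds
    ≡⟨ cong (_∸ 2 * length ds) (countᵇ-uncovered n ds inside disjoint-all) ⟩
  n ∸ 2 * length ds                                          ∎
  where open ≡-Reasoning

length-tiling≤⌊n/2⌋ : ∀ n ds → IsTiling n ds → length ds ≤ ⌊ n /2⌋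
length-tiling≤⌊n/2⌋ n ds (inside , disjoint-all) = begin
  length ds                                 ≡⟨ n≡⌊n+n/2⌋ (length ds) ⟩
  ⌊ length ds + length ds /2⌋               ≡⟨ cong ⌊_/2⌋ (cong (length ds +_) (+-identityʳ (length ds))) ⟨
  ⌊ 2 * length ds /2⌋                       ≤⟨ ⌊n/2⌋-mono (m≤n+m (2 * length ds) (countᵇ (uncovered ds) (upTo n))) ⟩
  ⌊ countᵇ (uncovered ds) (upTo n) + 2 * length ds /2⌋
    ≡⟨ cong ⌊_/2⌋ (countᵇ-uncovered n ds inside disjoint-all) ⟩
  ⌊ n /2⌋                                   ∎
  where open ≤-Reasoning

sum-map-by-value : ∀ {A : Set} K (f : A → ℕ) (G : ℕ → ℕ) xs → All (λ x → f x ≤ K) xs →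
  sum (map (G ∘ f) xs) ≡ Σ< (suc K) (λ k → length (filter (λ x → f x ≟ k) xs) * G k)
sum-map-by-value K f G []       []           = sym (Σ<-zero (suc K) _ (λ _ → refl))
sum-map-by-value K f G (x ∷ xs) (fx≤K ∷ ≤K) = sym (begin
  Σ< (suc K) (λ k → length (filter (λ y → f y ≟ k) (x ∷ xs)) * G k)
    ≡⟨ Σ<-cong (suc K) (λ k _ → trans (cong (_* G k) (length-filter-∷ k)) (*-distribʳ-+ (G k) (δ (f x) k) _)) ⟩
  Σ< (suc K) (λ k → δ (f x) k * G k + length (filter (λ y → f y ≟ k) xs) * G k)
    ≡⟨ Σ<-+ (suc K) (λ k → δ (f x) k * G k) (λ k → length (filter (λ y → f y ≟ k) xs) * G k) ⟩
  Σ< (suc K) (λ k → δ (f x) k * G k) + Σ< (suc K) (λ k → length (filter (λ y → f y ≟ k) xs) * G k)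
    ≡⟨ cong₂ _+_ (Σ<-δ (suc K) (f x) G (s≤s fx≤K)) (sym (sum-map-by-value K f G xs ≤K)) ⟩
  G (f x) + sum (map (G ∘ f) xs)
    ∎)
  where
  open ≡-Reasoning
  length-filter-∷ : ∀ k →
    length (filter (λ y → f y ≟ k) (x ∷ xs)) ≡ δ (f x) k + length (filter (λ y → f y ≟ k) xs)
  length-filter-∷ k with f x ≡ᵇ k
  ... | true  = refl
  ... | false = refl

c≡binomialCount : ∀ n k → c n k ≡ binomialCount n k
c≡binomialCount n k = trans (c≡matchingCount n k) (matchingCount≡binomialCount n k)

Σ≤-*ʳ : ∀ k (f : ℕ → ℕ) x → Σ≤ k f * x ≡ Σ≤ k (λ m → f m * x)
Σ≤-*ʳ k f x = trans (cong (_* x) (Σ≤≡Σ< k f)) (trans (sym (Σ<-*ʳ (suc k) f x)) (sym (Σ≤≡Σ< k (λ m → f m * x))))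

h≡Σc : ∀ a b n → h a b n ≡ Σ≤ ⌊ n /2⌋ (λ k → c n k * (a ^ (n ∸ 2 * k)) * (b ^ k))
h≡Σc a b n = begin
  h a b n
    ≡⟨ h≡sum-tilings a b n ⟩
  sum (map (λ ds → a ^ length (monomers n ds) * b ^ length ds) (tilings n))
    ≡⟨ sum-map-cong-All _ (G ∘ length)
                        (λ {ds} tiling → cong (λ m → a ^ m * b ^ length ds) (length-monomers-tiling n ds tiling))
                        (tilings-IsTiling n) ⟩
  sum (map (G ∘ length) (tilings n))
    ≡⟨ sum-map-by-value ⌊ n /2⌋ length G (tilings n) (All.map (length-tiling≤⌊n/2⌋ n _) (tilings-IsTiling n)) ⟩
  Σ< (suc ⌊ n /2⌋) (λ k → c n k * G k)
    ≡⟨ Σ<-cong (suc ⌊ n /2⌋) (λ k _ → *-assoc (c n k) (a ^ (n ∸ 2 * k)) (b ^ k)) ⟨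
  Σ< (suc ⌊ n /2⌋) (λ k → c n k * (a ^ (n ∸ 2 * k)) * (b ^ k))
    ≡⟨ Σ≤≡Σ< ⌊ n /2⌋ _ ⟨
  Σ≤ ⌊ n /2⌋ (λ k → c n k * (a ^ (n ∸ 2 * k)) * (b ^ k))
    ∎
  where
  open ≡-Reasoning
  G : ℕ → ℕ
  G k = a ^ (n ∸ 2 * k) * b ^ k

theorem4 : (a b : ℕ) → 1 ≤ a → 1 ≤ b → (n : ℕ) →
    (h a b n ≡ Σ≤ ⌊ n /2⌋ (λ k → c n k * (a ^ (n ∸ 2 * k)) * (b ^ k)))
    × (h a b n ≡ Σ≤ ⌊ n /2⌋ (λ k → Σ≤ k (λ m →
         ((n ∸ k ∸ m) C m) * ((n ∸ k ∸ m) C (k ∸ m)) * (a ^ (n ∸ 2 * k)) * (b ^ k))))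
theorem4 a b _ _ n = h≡Σc a b n , trans (h≡Σc a b n) (cong sum (map-cong c-term (upTo (suc ⌊ n /2⌋))))
  where
  c-term : ∀ k → c n k * (a ^ (n ∸ 2 * k)) * (b ^ k)
               ≡ Σ≤ k (λ m → ((n ∸ k ∸ m) C m) * ((n ∸ k ∸ m) C (k ∸ m)) * (a ^ (n ∸ 2 * k)) * (b ^ k))
  c-term k = begin
    c n k * (a ^ (n ∸ 2 * k)) * (b ^ k)
      ≡⟨ cong (λ x → x * (a ^ (n ∸ 2 * k)) * (b ^ k)) (c≡binomialCount n k) ⟩
    binomialCount n k * (a ^ (n ∸ 2 * k)) * (b ^ k)
      ≡⟨ cong (_* b ^ k) (Σ≤-*ʳ k binomials (a ^ (n ∸ 2 * k))) ⟩
    Σ≤ k (λ m → ((n ∸ k ∸ m) C m) * ((n ∸ k ∸ m) C (k ∸ m)) * (a ^ (n ∸ 2 * k))) * (b ^ k)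
      ≡⟨ Σ≤-*ʳ k (λ m → binomials m * (a ^ (n ∸ 2 * k))) (b ^ k) ⟩
    Σ≤ k (λ m → ((n ∸ k ∸ m) C m) * ((n ∸ k ∸ m) C (k ∸ m)) * (a ^ (n ∸ 2 * k)) * (b ^ k))
      ∎
    where
    open ≡-Reasoning
    binomials : ℕ → ℕ
    binomials m = ((n ∸ k ∸ m) C m) * ((n ∸ k ∸ m) C (k ∸ m))
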